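{- For all integers $\Delta\geq d\geq 1$ and $h\geq1$, the minimum number of degree-$d$ subtrees that cover the (non-rooted) complete $\Delta$-ary tree of height $h$ equals $$\left\lceil\frac{\Delta}{d}\left\lceil\frac{\Delta-1}{d-1}\right\rceil^{(h-1)}\right\rceil,$$ where $\lceil x\rceil^{(0)}:=1$ and $\lceil x\rceil^{(k)}:=\lceil x\cdot\lceil x\rceil^{(k-1)}\rceil$ for $k\geq1$.
   Context: For $\Delta\geq2$ and $h\geq1$, the complete $\Delta$-ary tree of height $h$ is the tree in which every non-leaf vertex has degree $\Delta$ and, for some vertex $r$, every leaf is at distance $h$ from $r$. A covering of a graph is a set of connected subgraphs such that every edge is in at least one subgraph; a subgraph is degree-$d$ if its maximum degree is at most $d$. -}

module Defs where

open import Data.Nat using (ℕ; zero; suc; _+_; _*_; _∸_; _≤_)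
open import Data.Nat.DivMod using (_/_)
open import Data.Fin using (Fin)
open import Data.Bool using (Bool; T)
open import Data.Empty using (⊥)
open import Data.Product using (Σ; ∃; _×_; Σ-syntax; ∃-syntax)
open import Relation.Binary.PropositionalEquality using (_≡_)
open import Function.Definitions using (Injective)

-- Ceiling of a rational a / b, for b ≥ 1 (junk value 0 when b = 0; the
-- theorem only uses it with a nonzero denominator).
ceilDiv : ℕ → ℕ → ℕ
ceilDiv a zero    = 0
ceilDiv a (suc b) = (a + b) / suc b

ceilIter : ℕ → ℕ → ℕ → ℕ
ceilIter p q zero    = 1
ceilIter p q (suc k) = ceilDiv (p * ceilIter p q k) q

formula : ℕ → ℕ → ℕ → ℕ
formula Δ d h = ceilDiv (Δ * ceilIter (Δ ∸ 1) (d ∸ 1) (h ∸ 1)) d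

-- Vertices at depth k are encoded by the path from the central vertex r:
-- r has Δ children, every other non-leaf vertex has Δ - 1 children, so
-- every non-leaf vertex has degree Δ; leaves are at depth h.

data TV (Δ : ℕ) : ℕ → Set where
  root : TV Δ 0
  top  : Fin Δ → TV Δ 1
  ext  : ∀ {k} → Fin (Δ ∸ 1) → TV Δ (suc k) → TV Δ (suc (suc k))

data Child {Δ : ℕ} : ∀ {k} → TV Δ k → TV Δ (suc k) → Set where
  child-top : (i : Fin Δ) → Child root (top i)
  child-ext : ∀ {k} (i : Fin (Δ ∸ 1)) (u : TV Δ (suc k)) → Child u (ext i u)

Vertex : ℕ → ℕ → Set
Vertex Δ h = Σ[ k ∈ ℕ ] (k ≤ h × TV Δ k)

data Adj {Δ h : ℕ} : Vertex Δ h → Vertex Δ h → Set where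
  down : ∀ {k} {p : k ≤ h} {q : suc k ≤ h} {u : TV Δ k} {w : TV Δ (suc k)} →
         Child u w → Adj (k Data.Product., (p Data.Product., u))
                         (suc k Data.Product., (q Data.Product., w))
  up   : ∀ {k} {p : k ≤ h} {q : suc k ≤ h} {u : TV Δ k} {w : TV Δ (suc k)} →
         Child u w → Adj (suc k Data.Product., (q Data.Product., w))
                         (k Data.Product., (p Data.Product., u))

module _ {V : Set} (E : V → V → Set) where

  record Subgraph : Set where
    field
      vs     : V → Bool
      es     : V → V → Bool
      es⊆E   : ∀ u v → T (es u v) → E u v
      es-sym : ∀ u v → T (es u v) → T (es v u)
      es-end : ∀ u v → T (es u v) → T (vs u)

  open Subgraph public

  data Walk (H : Subgraph) : V → V → Set where
    here : ∀ {u} → Walk H u u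
    step : ∀ {u w v} → T (es H u w) → Walk H w v → Walk H u v

  Connected : Subgraph → Set
  Connected H = ∀ u v → T (vs H u) → T (vs H v) → Walk H u v

  MaxDeg≤ : ℕ → Subgraph → Set
  MaxDeg≤ d H = ∀ (v : V) (f : Fin (suc d) → V) →
                Injective _≡_ _≡_ f → (∀ i → T (es H v (f i))) → ⊥

  DegCovering : ℕ → ℕ → Set
  DegCovering d m =
    Σ[ C ∈ (Fin m → Subgraph) ]
      ((∀ i → Connected (C i)) ×
       (∀ i → MaxDeg≤ d (C i)) ×
       (∀ u v → E u v → ∃[ i ] T (es (C i) u v)))

  IsMinDegCoverNumber : ℕ → ℕ → Set
  IsMinDegCoverNumber d k = DegCovering d k × (∀ m → DegCovering d m → k ≤ m)

{-# OPTIONS --safe #-}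

-- Write X = Δ − 1, Y = d − 1 and c₀ = 1, c_{j+1} = ⌈X c_j / Y⌉, so that the formula is ⌈Δ c_{h−1} / d⌉.
--
-- Lower bound. A top of a subgraph H is a vertex of H whose edge to its parent is not in H. If H is
-- connected, all of H lies below each of its tops, since otherwise H would use the edge from that top
-- to its parent; so H has at most one top. Let u be a non-root
-- vertex with j levels below it, A(u) the number of pieces through the edge from u to its parent, and
-- S(u) the number of (piece, top) pairs in the subtree of u. A piece through that edge uses at most Y
-- child edges of u; any other piece uses at most d of them and then has its top at u. Summing over the
-- X children gives X c_{j−1} ≤ Y A(u) + d S(u) ≤ Y (A(u) + d S(u)), hence c_j ≤ A(u) + d S(u). The same
-- count at the root gives Δ c_{h−1} ≤ d m, because each of the m pieces has one top.
--
-- Upper bound. A vertex of depth k ≥ 1 gets c_{h−k} slots, copies of the edge to its parent. Slot s of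
-- child i of a vertex is routed to slot ⌊(s X + i) / Y⌋ of that vertex, and slot s of root child i to the
-- piece ⌊(s Δ + i) / d⌋; these are injective in s and at most Y (resp. d) slots share an image. A piece
-- consists of the edges having a slot routed to it: it is connected because routing goes upwards, and
-- each vertex has at most Y children in it plus its parent, or at most d children at the root.
module Submission where

open import Defs
open import Data.Nat using (ℕ; zero; suc; _+_; _*_; _∸_; _≤_; _<_; z≤n; s≤s; _≟_; _≤?_; NonZero)
open import Data.Nat.Properties
open import Data.Nat.DivMod
open import Data.Nat.Divisibility using (∣-refl)
open import Data.Nat.Tactic.RingSolver using (solve-∀)
open import Data.Fin using (Fin; zero; suc; toℕ; fromℕ<)
import Data.Fin.Properties as Fin
open import Data.Bool using (Bool; true; false; T; _∧_; _∨_; not)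
open import Data.Bool.Properties using (T?; T-∧; T-not-≡; ∧-identityʳ)
open import Function.Bundles using (Equivalence)
open import Data.Empty using (⊥; ⊥-elim)
open import Data.Sum using (_⊎_; inj₁; inj₂; [_,_])
open import Data.Product using (∃₂; _×_; _,_; proj₁; proj₂; uncurry; Σ-syntax; ∃-syntax)
open import Data.List using (List; []; _∷_; length)
import Data.List.Properties as List
import Data.Vec.Functional as Vec
open import Data.List.Relation.Binary.Pointwise as Pointwise using (Pointwise-≡⇒≡; Pointwise-length)
open import Data.List.Relation.Binary.Suffix.Heterogeneous using (Suffix; here; there)
import Data.List.Relation.Binary.Suffix.Heterogeneous.Properties as Suffix
open import Relation.Nullary using (¬_; Dec; yes; no)
open import Relation.Binary.Definitions using (tri<; tri≈; tri>; DecidableEquality)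
open import Relation.Nullary.Decidable using (recompute; ⌊_⌋; True; toWitness; fromWitness; _×-dec_; _⊎-dec_)
import Relation.Nullary.Decidable as Dec
open import Relation.Binary.PropositionalEquality
  using (_≡_; refl; sym; trans; cong; cong₂; subst; module ≡-Reasoning)
open import Function.Base using (_∘_)
open import Function.Definitions using (Injective)
open import Algebra.Properties.Semiring.Sum +-*-semiring
  using (sum; sum-syntax; ∑-distrib-+; ∑-comm; sum-cong-≗; sum-replicate-zero; *-distribˡ-sum)

-- Ceilings and strides

ceilDiv-≤ : ∀ a b x → a ≤ suc b * x → ceilDiv a (suc b) ≤ x
ceilDiv-≤ a b x a≤ = ≤-pred (m<n*o⇒m/o<n (begin-strict
  a + b                 ≤⟨ +-monoˡ-≤ b a≤ ⟩
  suc b * x + b         <⟨ n<1+n _ ⟩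
  suc (suc b * x + b)   ≡⟨ rearrange b x ⟩
  suc x * suc b         ∎))
  where
  open ≤-Reasoning
  rearrange : ∀ b x → suc (suc b * x + b) ≡ suc x * suc b
  rearrange = solve-∀

≤-*-ceilDiv : ∀ a b → a ≤ suc b * ceilDiv a (suc b)
≤-*-ceilDiv a b = +-cancelʳ-≤ b a _ (begin
  a + b                                    ≡⟨ m≡m%n+[m/n]*n (a + b) (suc b) ⟩
  (a + b) % suc b + (a + b) / suc b * suc b ≤⟨ +-monoˡ-≤ _ (≤-pred (m%n<n (a + b) (suc b))) ⟩
  b + (a + b) / suc b * suc b               ≡⟨ rearrange b ((a + b) / suc b) ⟩
  suc b * ((a + b) / suc b) + b             ∎)
  where
  open ≤-Reasoning
  rearrange : ∀ b q → b + q * suc b ≡ suc b * q + b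
  rearrange = solve-∀

stride-/-< : ∀ {a b n s i} → s < n → i < a → (s * a + i) / suc b < ceilDiv (a * n) (suc b)
stride-/-< {a} {b} {n} {s} {i} s<n i<a = m<n*o⇒m/o<n (begin-strict
  s * a + i                           <⟨ +-monoʳ-< (s * a) i<a ⟩
  s * a + a                           ≡⟨ +-comm (s * a) a ⟩
  suc s * a                           ≤⟨ *-monoˡ-≤ a s<n ⟩
  n * a                               ≡⟨ *-comm n a ⟩
  a * n                               ≤⟨ ≤-*-ceilDiv (a * n) b ⟩
  suc b * ceilDiv (a * n) (suc b)     ≡⟨ *-comm (suc b) _ ⟩
  ceilDiv (a * n) (suc b) * suc b     ∎)
  where open ≤-Reasoning

stride-/-strictMono : ∀ {a b r s s′} → suc b ≤ a → s < s′ → (s * a + r) / suc b < (s′ * a + r) / suc b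
stride-/-strictMono {a} {b} {r} {s} {s′} b<a s<s′ = begin-strict
  (s * a + r) / suc b              <⟨ n<1+n _ ⟩
  suc ((s * a + r) / suc b)        ≡⟨ [m+n]/n≡1+m/n (s * a + r) b ⟨
  (s * a + r + suc b) / suc b      ≤⟨ /-monoˡ-≤ (suc b) gap ⟩
  (s′ * a + r) / suc b             ∎
  where
  open ≤-Reasoning
  [m+n]/n≡1+m/n : ∀ m n → (m + suc n) / suc n ≡ suc (m / suc n)
  [m+n]/n≡1+m/n m n = trans (+-distrib-/-∣ʳ m ∣-refl) (trans (cong (m / suc n +_) (n/n≡1 (suc n))) (+-comm _ 1))
  gap : s * a + r + suc b ≤ s′ * a + r
  gap = begin
    s * a + r + suc b   ≡⟨ +-assoc (s * a) r (suc b) ⟩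
    s * a + (r + suc b) ≡⟨ cong (s * a +_) (+-comm r (suc b)) ⟩
    s * a + (suc b + r) ≤⟨ +-monoʳ-≤ (s * a) (+-monoˡ-≤ r b<a) ⟩
    s * a + (a + r)     ≡⟨ +-assoc (s * a) a r ⟨
    s * a + a + r       ≡⟨ cong (_+ r) (+-comm (s * a) a) ⟩
    suc s * a + r       ≤⟨ +-monoˡ-≤ r (*-monoˡ-≤ a s<s′) ⟩
    s′ * a + r          ∎

stride-/-injective : ∀ {a b r s s′} → suc b ≤ a → (s * a + r) / suc b ≡ (s′ * a + r) / suc b → s ≡ s′
stride-/-injective {s = s} {s′} b<a eq with <-cmp s s′
... | tri< s<s′ _ _ = ⊥-elim (<-irrefl eq (stride-/-strictMono b<a s<s′))
... | tri≈ _ s≡s′ _ = s≡s′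
... | tri> _ _ s>s′ = ⊥-elim (<-irrefl (sym eq) (stride-/-strictMono b<a s>s′))

/-%-injective : ∀ {x y} n .{{_ : NonZero n}} → x / n ≡ y / n → x % n ≡ y % n → x ≡ y
/-%-injective {x} {y} n quot rem = begin
  x                   ≡⟨ m≡m%n+[m/n]*n x n ⟩
  x % n + x / n * n   ≡⟨ cong₂ (λ r q → r + q * n) rem quot ⟩
  y % n + y / n * n   ≡⟨ m≡m%n+[m/n]*n y n ⟨
  y                   ∎
  where open ≡-Reasoning

stride-digit-injective : ∀ {a s s′ i i′} .{{_ : NonZero a}} → i < a → i′ < a →
                         s * a + i ≡ s′ * a + i′ → i ≡ i′
stride-digit-injective {a} {s} {s′} {i} {i′} i<a i′<a eq = begin
  i                    ≡⟨ m<n⇒m%n≡m i<a ⟨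
  i % a                ≡⟨ [m+kn]%n≡m%n i s a ⟨
  (i + s * a) % a      ≡⟨ cong (_% a) (trans (+-comm i (s * a)) (trans eq (+-comm (s′ * a) i′))) ⟩
  (i′ + s′ * a) % a    ≡⟨ [m+kn]%n≡m%n i′ s′ a ⟩
  i′ % a               ≡⟨ m<n⇒m%n≡m i′<a ⟩
  i′                   ∎
  where open ≡-Reasoning

∸-suc : ∀ {h n} → suc n ≤ h → h ∸ n ≡ suc (h ∸ suc n)
∸-suc {suc h} {zero}  _         = refl
∸-suc {suc h} {suc n} (s≤s n<h) = ∸-suc n<h

-- Finite sums

𝟙 : Bool → ℕ
𝟙 true  = 1
𝟙 false = 0

𝟙≤1 : ∀ b → 𝟙 b ≤ 1
𝟙≤1 true  = s≤s z≤n
𝟙≤1 false = z≤n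

T⇒𝟙≡1 : ∀ {b} → T b → 𝟙 b ≡ 1
T⇒𝟙≡1 {true} _ = refl

¬T⇒𝟙≡0 : ∀ {b} → ¬ T b → 𝟙 b ≡ 0
¬T⇒𝟙≡0 {true}  ¬t = ⊥-elim (¬t _)
¬T⇒𝟙≡0 {false} _  = refl

𝟙-positive⇒T : ∀ {b} → 1 ≤ 𝟙 b → T b
𝟙-positive⇒T {true} _ = _

sum-mono-≤ : ∀ {n} {f g : Fin n → ℕ} → (∀ i → f i ≤ g i) → sum f ≤ sum g
sum-mono-≤ {zero}  f≤g = z≤n
sum-mono-≤ {suc n} f≤g = +-mono-≤ (f≤g zero) (sum-mono-≤ (f≤g ∘ suc))

sum-const : ∀ n c → ∑[ i < n ] c ≡ n * c
sum-const zero    c = refl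
sum-const (suc n) c = cong (c +_) (sum-const n c)

sum-+-* : ∀ {n} a (f g : Fin n → ℕ) → ∑[ i < n ] (f i + a * g i) ≡ sum f + a * sum g
sum-+-* a f g = trans (∑-distrib-+ f (λ i → a * g i)) (sym (cong (sum f +_) (*-distribˡ-sum a g)))

sum-linear : ∀ {n} a b (f g : Fin n → ℕ) →
             ∑[ i < n ] (a * f i + b * g i) ≡ a * sum f + b * sum g
sum-linear a b f g = trans (∑-distrib-+ (λ i → a * f i) (λ i → b * g i))
  (sym (cong₂ _+_ (*-distribˡ-sum a f) (*-distribˡ-sum b g)))

sum-zero : ∀ {n} {f : Fin n → ℕ} → (∀ i → f i ≡ 0) → sum f ≡ 0
sum-zero {n} f≡0 = trans (sum-cong-≗ f≡0) (sum-replicate-zero n)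

≤-sum : ∀ {n} (f : Fin n → ℕ) i → f i ≤ sum f
≤-sum f zero    = m≤m+n (f zero) _
≤-sum f (suc i) = ≤-trans (≤-sum (f ∘ suc) i) (m≤n+m _ (f zero))

sum-positive : ∀ {n} (f : Fin n → ℕ) → 1 ≤ sum f → ∃[ i ] 1 ≤ f i
sum-positive {suc n} f pos with f zero in eq
... | suc _ = zero , subst (1 ≤_) (sym eq) (s≤s z≤n)
... | zero with sum-positive (f ∘ suc) pos
...   | i , fi≥1 = suc i , fi≥1

sum-≤1 : ∀ {n} (f : Fin n → ℕ) → (∀ i → f i ≤ 1) →
         (∀ i j → 1 ≤ f i → 1 ≤ f j → i ≡ j) → sum f ≤ 1
sum-≤1 {zero}  f f≤1 unique = z≤n
sum-≤1 {suc n} f f≤1 unique with f zero in eq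
... | zero  = sum-≤1 (f ∘ suc) (f≤1 ∘ suc) λ i j p q → Fin.suc-injective (unique _ _ p q)
... | suc m = begin
  suc m + sum (f ∘ suc) ≡⟨ cong (suc m +_) (sum-zero tail≡0) ⟩
  suc m + 0             ≡⟨ +-identityʳ (suc m) ⟩
  suc m                 ≡⟨ eq ⟨
  f zero                ≤⟨ f≤1 zero ⟩
  1                     ∎
  where
  open ≤-Reasoning
  tail≡0 : ∀ i → f (suc i) ≡ 0
  tail≡0 i = n≤0⇒n≡0 (≮⇒≥ λ fi≥1 →
    Fin.0≢1+n (unique zero (suc i) (subst (1 ≤_) (sym eq) (s≤s z≤n)) fi≥1))

injectionInto : ∀ {n} (b : Fin n → Bool) {r} → r ≤ ∑[ i < n ] 𝟙 (b i) →
                Σ[ e ∈ (Fin r → Fin n) ] Injective _≡_ _≡_ e × (∀ j → T (b (e j)))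
injectionInto b {zero} _ = (λ ()) , (λ { {()} }) , (λ ())
injectionInto {suc n} b {suc r} r≤ with b zero in b₀
... | false with injectionInto (b ∘ suc) r≤
...   | e , e-inj , marked = suc ∘ e , e-inj ∘ Fin.suc-injective , marked
injectionInto {suc n} b {suc r} r≤ | true with injectionInto (b ∘ suc) (≤-pred r≤)
...   | e , e-inj , marked = e′ , e′-inj , marked′
  where
  e′ : Fin (suc r) → Fin (suc n)
  e′ zero    = zero
  e′ (suc j) = suc (e j)
  e′-inj : Injective _≡_ _≡_ e′
  e′-inj {zero}  {zero}  _  = refl
  e′-inj {suc i} {suc j} eq = cong suc (e-inj (Fin.suc-injective eq))
  marked′ : ∀ j → T (b (e′ j))
  marked′ zero    = subst T (sym b₀) _
  marked′ (suc j) = marked j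

-- Subgraphs

module _ {V : Set} {E : V → V → Set} (H : Subgraph E) where

  𝟙-es-sym : ∀ u v → 𝟙 (es H u v) ≡ 𝟙 (es H v u)
  𝟙-es-sym u v with es H u v in uv | es H v u in vu
  ... | true  | true  = refl
  ... | false | false = refl
  ... | true  | false = ⊥-elim (subst T vu (es-sym H u v (subst T (sym uv) _)))
  ... | false | true  = ⊥-elim (subst T uv (es-sym H v u (subst T (sym vu) _)))

  edges≤degree : ∀ {d} → MaxDeg≤ E d H → ∀ v {n} (g : Fin n → V) → Injective _≡_ _≡_ g →
                 ∑[ i < n ] 𝟙 (es H v (g i)) ≤ d * 𝟙 (vs H v)
  edges≤degree {d} maxDeg v {n} g g-inj with vs H v in v∈H
  ... | true = subst (_ ≤_) (sym (*-identityʳ d)) count≤d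
    where
    count≤d : ∑[ i < n ] 𝟙 (es H v (g i)) ≤ d
    count≤d with _ ≤? d
    ... | yes ≤d = ≤d
    ... | no  >d with injectionInto (λ i → es H v (g i)) (≰⇒> >d)
    ...   | e , e-inj , marked = ⊥-elim (maxDeg v (g ∘ e) (e-inj ∘ g-inj) marked)
  ... | false = ≤-reflexive (trans (sum-zero λ i → ¬T⇒𝟙≡0 λ t → subst T v∈H (es-end H v (g i) t))
                                   (sym (*-zeroʳ d)))

  maxDeg≤-byCode : ∀ {d} →
    (code : ∀ {v w} → T (es H v w) → ℕ) → (∀ {v w} (t : T (es H v w)) → code t < d) →
    (∀ {v w w′} (t : T (es H v w)) (t′ : T (es H v w′)) → code t ≡ code t′ → w ≡ w′) →
    MaxDeg≤ E d H
  maxDeg≤-byCode {d} code code<d code-inj v f f-inj edge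
    with Fin.pigeonhole (n<1+n d) (λ i → fromℕ< (code<d (edge i)))
  ... | i , j , i<j , same = Fin.<⇒≢ i<j (f-inj (code-inj (edge i) (edge j) (begin
    code (edge i)                         ≡⟨ Fin.toℕ-fromℕ< _ ⟨
    toℕ (fromℕ< (code<d (edge i)))        ≡⟨ cong toℕ same ⟩
    toℕ (fromℕ< (code<d (edge j)))        ≡⟨ Fin.toℕ-fromℕ< _ ⟩
    code (edge j)                         ∎)))
    where open ≡-Reasoning

module _ {V : Set} {E : V → V → Set} {H : Subgraph E} where

  _++ʷ_ : ∀ {a b c} → Walk E H a b → Walk E H b c → Walk E H a c
  here     ++ʷ w′ = w′
  step e w ++ʷ w′ = step e (w ++ʷ w′)

  reverseʷ : ∀ {a b} → Walk E H a b → Walk E H b a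
  reverseʷ here                = here
  reverseʷ (step {u} {w} e wk) = reverseʷ wk ++ʷ step (es-sym H u w e) here

-- The complete tree

depth≤h : ∀ {h} j {k} → j + k ≤ h → k ≤ h
depth≤h j {k} = ≤-trans (m≤n+m k j)

height-child : ∀ {h} j {k} → suc j + k ≤ h → j + suc k ≤ h
height-child j {k} = ≤-trans (≤-reflexive (+-suc j k))

infix 4 _≼_
_≼_ : List ℕ → List ℕ → Set
_≼_ = Suffix _≡_

[]≼ : ∀ ys → [] ≼ ys
[]≼ []       = here Pointwise.[]
[]≼ (y ∷ ys) = there ([]≼ ys)

≼-refl : ∀ {xs} → xs ≼ xs
≼-refl = here (Pointwise.refl refl)

≼-trans : ∀ {xs ys zs} → xs ≼ ys → ys ≼ zs → xs ≼ zs
≼-trans = Suffix.trans trans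

≼-∷⁻ : ∀ {xs y ys} → xs ≼ y ∷ ys → ¬ xs ≼ ys → xs ≡ y ∷ ys
≼-∷⁻ (here xs≡) _    = Pointwise-≡⇒≡ xs≡
≼-∷⁻ (there xs≼) xs⋠ = ⊥-elim (xs⋠ xs≼)

≼-unique : ∀ {xs ys zs} → xs ≼ zs → ys ≼ zs → length xs ≡ length ys → xs ≡ ys
≼-unique (here xs≡) (here ys≡) _ = trans (Pointwise-≡⇒≡ xs≡) (sym (Pointwise-≡⇒≡ ys≡))
≼-unique (there xs≼) (there ys≼) eq = ≼-unique xs≼ ys≼ eq
≼-unique (here xs≡) (there ys≼) eq =
  ⊥-elim (Suffix.S[as][bs]⇒∣as∣≢1+∣bs∣ ys≼ (trans (sym eq) (Pointwise-length xs≡)))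
≼-unique (there xs≼) (here ys≡) eq =
  ⊥-elim (Suffix.S[as][bs]⇒∣as∣≢1+∣bs∣ xs≼ (trans eq (Pointwise-length ys≡)))

≼-antisym : ∀ {xs ys} → xs ≼ ys → ys ≼ xs → xs ≡ ys
≼-antisym xs≼ys ys≼xs =
  ≼-unique xs≼ys ≼-refl (≤-antisym (Suffix.length-mono xs≼ys) (Suffix.length-mono ys≼xs))

module _ {Δ : ℕ} where

  -- Child indices read from the vertex up to the root, so that path u ≼ path w says that w lies in the subtree of u.
  path : ∀ {k} → TV Δ k → List ℕ
  path root      = []
  path (top i)   = toℕ i ∷ []
  path (ext i u) = toℕ i ∷ path u

  length-path : ∀ {k} (u : TV Δ k) → length (path u) ≡ k
  length-path root      = refl
  length-path (top i)   = refl
  length-path (ext i u) = cong suc (length-path u)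

  path-injective : ∀ {k} {u w : TV Δ k} → path u ≡ path w → u ≡ w
  path-injective {u = root}    {root}    _  = refl
  path-injective {u = top i}   {top j}   eq = cong top (Fin.toℕ-injective (List.∷-injectiveˡ eq))
  path-injective {u = ext i u} {ext j w} eq
    rewrite Fin.toℕ-injective {i = i} {j} (List.∷-injectiveˡ eq)
          | path-injective {u = u} {w} (List.∷-injectiveʳ eq) = refl

  parent : ∀ {k} → TV Δ (suc k) → TV Δ k
  parent (top i)   = root
  parent (ext i u) = u

  path-parent : ∀ {k} (w : TV Δ (suc k)) → ∃[ c ] path w ≡ c ∷ path (parent w)
  path-parent (top i)   = toℕ i , refl
  path-parent (ext i u) = toℕ i , refl

  child-parent : ∀ {k} (w : TV Δ (suc k)) → Child (parent w) w
  child-parent (top i)   = child-top i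
  child-parent (ext i u) = child-ext i u

  Child⇒parent : ∀ {k} {u : TV Δ k} {w} → Child u w → parent w ≡ u
  Child⇒parent (child-top i)   = refl
  Child⇒parent (child-ext i u) = refl

  _≟ᵀ_ : ∀ {k} → DecidableEquality (TV Δ k)
  u ≟ᵀ w = Dec.map′ path-injective (cong path) (List.≡-dec _≟_ (path u) (path w))

  child? : ∀ {k} (u : TV Δ k) (w : TV Δ (suc k)) → Dec (Child u w)
  child? u w = Dec.map′ (λ { refl → child-parent w }) Child⇒parent (parent w ≟ᵀ u)

  arity : ℕ → ℕ
  arity zero    = Δ
  arity (suc _) = Δ ∸ 1

  child : ∀ {k} → TV Δ k → Fin (arity k) → TV Δ (suc k)
  child {zero}  root i = top i
  child {suc k} u    i = ext i u

  path-child : ∀ {k} (u : TV Δ k) c → path (child u c) ≡ toℕ c ∷ path u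
  path-child {zero}  root c = refl
  path-child {suc k} u    c = refl

  ≼-child : ∀ {k} (u : TV Δ k) c → path u ≼ path (child u c)
  ≼-child u c = subst (path u ≼_) (sym (path-child u c)) (there ≼-refl)

  child⋠ : ∀ {k} (u : TV Δ k) c → ¬ path (child u c) ≼ path u
  child⋠ u c cu≼u =
    1+n≰n (subst (_≤ length (path u)) (cong length (path-child u c)) (Suffix.length-mono cu≼u))

  ≼-child-unique : ∀ {k} (u : TV Δ k) {c c′ zs} →
                   path (child u c) ≼ zs → path (child u c′) ≼ zs → c ≡ c′
  ≼-child-unique u {c} {c′} c≼ c′≼ = Fin.toℕ-injective (List.∷-injectiveˡ (begin
    toℕ c ∷ path u     ≡⟨ path-child u c ⟨
    path (child u c)   ≡⟨ ≼-unique c≼ c′≼ (trans (cong length (path-child u c))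
                                                 (cong length (sym (path-child u c′)))) ⟩
    path (child u c′)  ≡⟨ path-child u c′ ⟩
    toℕ c′ ∷ path u    ∎))
    where open ≡-Reasoning

module _ {Δ h : ℕ} where

  -- All proofs of k ≤ h give the same vertex, definitionally.
  vertex : ∀ {k} → .(k ≤ h) → TV Δ k → Vertex Δ h
  vertex {k} k≤h u = k , recompute (k ≤? h) k≤h , u

  data ParentOf : Vertex Δ h → Vertex Δ h → Set where
    parentOf : ∀ {k q q′} {u : TV Δ k} {w : TV Δ (suc k)} → Child u w → ParentOf (k , q , u) (suc k , q′ , w)

  parentOf? : ∀ x y → Dec (ParentOf x y)
  parentOf? (k , _ , u) (k′ , _ , w) with k′ ≟ suc k
  ... | no  k′≢1+k = no λ { (parentOf _) → k′≢1+k refl }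
  ... | yes refl   = Dec.map′ parentOf (λ { (parentOf ch) → ch }) (child? u w)

  ParentOf⇒Adj : ∀ {x y} → ParentOf x y → Adj x y × Adj y x
  ParentOf⇒Adj (parentOf ch) = down ch , up ch

  vertex-cong : ∀ {k} {q q′ : k ≤ h} {u u′ : TV Δ k} → u ≡ u′ → (k , q , u) ≡ (k , q′ , u′)
  vertex-cong {k} {q} {q′} {u} refl = cong {B = Vertex Δ h} (λ q → k , q , u) (≤-irrelevant q q′)

  pathᵥ : Vertex Δ h → List ℕ
  pathᵥ (_ , _ , u) = path u

  pathᵥ-injective : ∀ {x y : Vertex Δ h} → pathᵥ x ≡ pathᵥ y → x ≡ y
  pathᵥ-injective {k , k≤h , u} {k′ , k′≤h , u′} eq
    with trans (sym (length-path u)) (trans (cong length eq) (length-path u′))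
  ... | refl rewrite path-injective {u = u} {u′} eq | ≤-irrelevant k≤h k′≤h = refl

  Adj⇒path : ∀ {x y : Vertex Δ h} → Adj x y →
             (∃[ c ] pathᵥ y ≡ c ∷ pathᵥ x) ⊎ (∃[ c ] pathᵥ x ≡ c ∷ pathᵥ y)
  Adj⇒path (down (child-top i))   = inj₁ (toℕ i , refl)
  Adj⇒path (down (child-ext i u)) = inj₁ (toℕ i , refl)
  Adj⇒path (up (child-top i))     = inj₂ (toℕ i , refl)
  Adj⇒path (up (child-ext i u))   = inj₂ (toℕ i , refl)

  subtreeSum : (Vertex Δ h → ℕ) → ∀ j {k} → .(j + k ≤ h) → TV Δ k → ℕ
  subtreeTerms : (Vertex Δ h → ℕ) → ∀ j {k} → .(suc j + k ≤ h) → TV Δ k →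
                 Vec.Vector ℕ (suc (arity k))

  subtreeSum f zero    j+k≤h u = f (vertex (depth≤h 0 j+k≤h) u)
  subtreeSum f (suc j) j+k≤h u = sum (subtreeTerms f j j+k≤h u)

  subtreeTerms f j j+k≤h u =
    f (vertex (depth≤h (suc j) j+k≤h) u) Vec.∷ λ c → subtreeSum f j (height-child j j+k≤h) (child u c)

  subtreeSum-witness : ∀ f j {k} .(j+k≤h : j + k ≤ h) (u : TV Δ k) →
                       1 ≤ subtreeSum f j j+k≤h u → ∃[ x ] path u ≼ pathᵥ x × 1 ≤ f x
  subtreeSum-witness f zero    _     u pos = _ , ≼-refl , pos
  subtreeSum-witness f (suc j) j+k≤h u pos with sum-positive (subtreeTerms f j j+k≤h u) pos
  ... | zero  , fu≥1 = _ , ≼-refl , fu≥1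
  ... | suc c , sub≥1 with subtreeSum-witness f j _ (child u c) sub≥1
  ...   | x , cu≼x , fx≥1 = x , ≼-trans (≼-child u c) cu≼x , fx≥1

  subtreeSum-≤1 : ∀ f → (∀ x → f x ≤ 1) → (∀ x y → 1 ≤ f x → 1 ≤ f y → x ≡ y) →
                  ∀ j {k} .(j+k≤h : j + k ≤ h) (u : TV Δ k) → subtreeSum f j j+k≤h u ≤ 1
  subtreeSum-≤1 f f≤1 f-unique zero    _     u = f≤1 _
  subtreeSum-≤1 f f≤1 f-unique (suc j) j+k≤h u = sum-≤1 (subtreeTerms f j j+k≤h u) terms≤1 positive-unique
    where
    terms≤1 : ∀ i → subtreeTerms f j j+k≤h u i ≤ 1
    terms≤1 zero    = f≤1 _
    terms≤1 (suc c) = subtreeSum-≤1 f f≤1 f-unique j _ (child u c)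

    node∉subtree : ∀ c → 1 ≤ subtreeTerms f j j+k≤h u zero → ¬ 1 ≤ subtreeTerms f j j+k≤h u (suc c)
    node∉subtree c fu≥1 sub≥1 with subtreeSum-witness f j _ (child u c) sub≥1
    ... | x , cu≼x , fx≥1 with f-unique _ x fu≥1 fx≥1
    ...   | refl = child⋠ u c cu≼x

    positive-unique : ∀ i i′ → 1 ≤ subtreeTerms f j j+k≤h u i → 1 ≤ subtreeTerms f j j+k≤h u i′ →
                      i ≡ i′
    positive-unique zero    zero     _ _ = refl
    positive-unique zero    (suc c)  p q = ⊥-elim (node∉subtree c p q)
    positive-unique (suc c) zero     p q = ⊥-elim (node∉subtree c q p)
    positive-unique (suc c) (suc c′) p q
      with subtreeSum-witness f j _ (child u c) p | subtreeSum-witness f j _ (child u c′) q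
    ... | x , cu≼x , fx≥1 | x′ , c′u≼x′ , fx′≥1 with f-unique x x′ fx≥1 fx′≥1
    ...   | refl = cong suc (≼-child-unique u cu≼x c′u≼x′)

  subtreeSum-∑ : ∀ {n} (g : Fin n → Vertex Δ h → ℕ) j {k} .(j+k≤h : j + k ≤ h) (u : TV Δ k) →
                 subtreeSum (λ x → ∑[ i < n ] g i x) j j+k≤h u ≡ ∑[ i < n ] subtreeSum (g i) j j+k≤h u
  subtreeSum-∑ g zero    _     u = refl
  subtreeSum-∑ {n} g (suc j) {k} j+k≤h u = begin
    ∑[ i < n ] g i U + ∑[ c < arity k ] subtreeSum (λ x → ∑[ i < n ] g i x) j _ (child u c)
      ≡⟨ cong (∑[ i < n ] g i U +_) (sum-cong-≗ λ c → subtreeSum-∑ g j _ (child u c)) ⟩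
    ∑[ i < n ] g i U + ∑[ c < arity k ] ∑[ i < n ] subtreeSum (g i) j _ (child u c)
      ≡⟨ cong (∑[ i < n ] g i U +_) (∑-comm (λ c i → subtreeSum (g i) j _ (child u c))) ⟩
    ∑[ i < n ] g i U + ∑[ i < n ] ∑[ c < arity k ] subtreeSum (g i) j _ (child u c)
      ≡⟨ ∑-distrib-+ (λ i → g i U) (λ i → ∑[ c < arity k ] subtreeSum (g i) j _ (child u c)) ⟨
    ∑[ i < n ] (g i U + ∑[ c < arity k ] subtreeSum (g i) j _ (child u c)) ∎
    where
    open ≡-Reasoning
    U : Vertex Δ h
    U = vertex (depth≤h (suc j) j+k≤h) u

  children-injective : ∀ {k} .(k<h : k < h) (u : TV Δ k) →
                       Injective _≡_ _≡_ (λ c → vertex k<h (child u c))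
  children-injective _ u {c} {c′} eq = Fin.toℕ-injective (List.∷-injectiveˡ (begin
    toℕ c ∷ path u     ≡⟨ path-child u c ⟨
    path (child u c)   ≡⟨ cong pathᵥ eq ⟩
    path (child u c′)  ≡⟨ path-child u c′ ⟩
    toℕ c′ ∷ path u    ∎))
    where open ≡-Reasoning

  neighbours : ∀ {k} .(k<h : suc k < h) (u : TV Δ (suc k)) → Fin (suc (Δ ∸ 1)) → Vertex Δ h
  neighbours k<h u = vertex (≤-trans (n≤1+n _) (<⇒≤ k<h)) (parent u) Vec.∷ λ c → vertex k<h (child u c)

  neighbours-injective : ∀ {k} .(k<h : suc k < h) (u : TV Δ (suc k)) → Injective _≡_ _≡_ (neighbours k<h u)
  neighbours-injective k<h u {zero}  {zero}   _  = refl
  neighbours-injective k<h u {suc c} {suc c′} eq = cong suc (children-injective k<h u eq)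
  neighbours-injective k<h u {zero}  {suc c′} eq = ⊥-elim (m≢1+n+m _ {1} (cong proj₁ eq))
  neighbours-injective k<h u {suc c} {zero}   eq = ⊥-elim (m≢1+n+m _ {1} (sym (cong proj₁ eq)))

-- Tops of connected subtrees

module _ {Δ h : ℕ} (H : Subgraph (Adj {Δ} {h})) where

  exitEdge : ∀ {a b} → Walk Adj H a b → ∀ {s} → s ≼ pathᵥ a → ¬ s ≼ pathᵥ b →
             ∃₂ λ x y → T (es H x y) × pathᵥ x ≡ s × ∃[ c ] pathᵥ x ≡ c ∷ pathᵥ y
  exitEdge here s≼a s⋠b = ⊥-elim (s⋠b s≼a)
  exitEdge {a} (step {w = w} e walk) {s} s≼a s⋠b with Suffix.suffix? _≟_ s (pathᵥ w)
  ... | yes s≼w = exitEdge walk s≼w s⋠b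
  ... | no  s⋠w with Adj⇒path (es⊆E H a w e)
  ...   | inj₁ (c , w≡c∷a) = ⊥-elim (s⋠w (subst (s ≼_) (sym w≡c∷a) (there s≼a)))
  ...   | inj₂ (c , a≡c∷w) =
    a , w , e , trans a≡c∷w (sym (≼-∷⁻ (subst (s ≼_) a≡c∷w s≼a) s⋠w)) , c , a≡c∷w

  parentEdge-used : Connected Adj H → ∀ {W P a b c} → pathᵥ W ≡ c ∷ pathᵥ P →
                    T (vs H a) → T (vs H b) → pathᵥ W ≼ pathᵥ a → ¬ pathᵥ W ≼ pathᵥ b → T (es H W P)
  parentEdge-used conn {W} {P} W↑P a∈H b∈H W≼a W⋠b
    with exitEdge (conn _ _ a∈H b∈H) W≼a W⋠b
  ... | x , y , e , x≡W , c , x↑y with pathᵥ-injective {x = x} {W} x≡W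
  ...   | refl with pathᵥ-injective {x = y} {P} (List.∷-injectiveʳ (trans (sym x↑y) W↑P))
  ...     | refl = e

  isTop : Vertex Δ h → Bool
  isTop x@(zero  , _   , root) = vs H x
  isTop x@(suc k , k<h , w)    = vs H x ∧ not (es H x (vertex (<⇒≤ k<h) (parent w)))

  isTop⇒vs : ∀ {x} → T (isTop x) → T (vs H x)
  isTop⇒vs {zero  , _ , root} x∈H = x∈H
  isTop⇒vs {suc k , _ , w}    x-top = proj₁ (Equivalence.to T-∧ x-top)

  top≼ : Connected Adj H → ∀ {x y} → T (isTop x) → T (vs H y) → pathᵥ x ≼ pathᵥ y
  top≼ conn {zero , _ , root} _ _ = []≼ _
  top≼ conn {x@(suc k , _ , w)} {y} x-top y∈H
    with Equivalence.to T-∧ x-top | Suffix.suffix? _≟_ (path w) (pathᵥ y)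
  ... | _                  | yes w≼y = w≼y
  ... | x∈H , noParentEdge | no  w⋠y = ⊥-elim (subst T (Equivalence.to T-not-≡ noParentEdge)
          (parentEdge-used conn {x} (proj₂ (path-parent w)) x∈H y∈H ≼-refl w⋠y))

  top-unique : Connected Adj H → ∀ {x y} → T (isTop x) → T (isTop y) → x ≡ y
  top-unique conn tx ty =
    pathᵥ-injective (≼-antisym (top≼ conn tx (isTop⇒vs ty)) (top≼ conn ty (isTop⇒vs tx)))

-- Lower bound

childEdges≤ : ∀ Y p v s → 𝟙 p + s ≤ suc Y * 𝟙 v → s ≤ Y * 𝟙 p + suc Y * 𝟙 (v ∧ not p)
childEdges≤ Y true true s 1+s≤ =
  ≤-trans (≤-pred (≤-trans 1+s≤ (≤-reflexive (*-identityʳ (suc Y))))) (≤-reflexive (identity Y))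
  where
  identity : ∀ Y → Y ≡ Y * 1 + suc Y * 0
  identity = solve-∀
childEdges≤ Y true  false s 1+s≤ = ⊥-elim (n≮0 (≤-trans 1+s≤ (≤-reflexive (*-zeroʳ (suc Y)))))
childEdges≤ Y false v     s s≤ rewrite ∧-identityʳ v = ≤-trans s≤ (m≤n+m _ (Y * 0))

module LowerBound {Δ h m e : ℕ} (C : Fin m → Subgraph (Adj {Δ} {h}))
  (connected : ∀ i → Connected Adj (C i))
  (maxDeg : ∀ i → MaxDeg≤ Adj (suc (suc e)) (C i))
  (covers : ∀ u v → Adj u v → ∃[ i ] T (es (C i) u v)) where

  private
    d : ℕ
    d = suc (suc e)

  c[_] : ℕ → ℕ
  c[ j ] = ceilIter (Δ ∸ 1) (suc e) j

  multiplicity : Vertex Δ h → Vertex Δ h → ℕ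
  multiplicity x y = ∑[ i < m ] 𝟙 (es (C i) x y)

  tops : Vertex Δ h → ℕ
  tops x = ∑[ i < m ] 𝟙 (isTop (C i) x)

  subtreeSum-tops≤m : ∀ j {k} .(j+k≤h : j + k ≤ h) (u : TV Δ k) → subtreeSum tops j j+k≤h u ≤ m
  subtreeSum-tops≤m j j+k≤h u = begin
    subtreeSum tops j _ u                           ≡⟨ subtreeSum-∑ (λ i → 𝟙 ∘ isTop (C i)) j j+k≤h u ⟩
    ∑[ i < m ] subtreeSum (𝟙 ∘ isTop (C i)) j _ u   ≤⟨ sum-mono-≤ (λ i → pieceTops≤1 i) ⟩
    ∑[ i < m ] 1                                    ≡⟨ trans (sum-const m 1) (*-identityʳ m) ⟩
    m                                               ∎
    where
    open ≤-Reasoning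
    unique : ∀ i x y → 1 ≤ 𝟙 (isTop (C i) x) → 1 ≤ 𝟙 (isTop (C i) y) → x ≡ y
    unique i x y x-top y-top = top-unique (C i) (connected i) (𝟙-positive⇒T x-top) (𝟙-positive⇒T y-top)
    pieceTops≤1 : ∀ i → subtreeSum (𝟙 ∘ isTop (C i)) j j+k≤h u ≤ 1
    pieceTops≤1 i = subtreeSum-≤1 _ (𝟙≤1 ∘ isTop (C i)) (unique i) j j+k≤h u

  multiplicity-positive : ∀ {x y} → Adj x y → 1 ≤ multiplicity x y
  multiplicity-positive adj with covers _ _ adj
  ... | i , e = ≤-trans (≤-reflexive (sym (T⇒𝟙≡1 e))) (≤-sum _ i)

  multiplicity-towards : ∀ {n} (u : Vertex Δ h) (g : Fin n → Vertex Δ h) (F : Fin m → ℕ) →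
    (∀ i → ∑[ c < n ] 𝟙 (es (C i) u (g c)) ≤ F i) → ∑[ c < n ] multiplicity (g c) u ≤ sum F
  multiplicity-towards {n} u g F bound = begin
    ∑[ c < n ] ∑[ i < m ] 𝟙 (es (C i) (g c) u)  ≡⟨ ∑-comm (λ c i → 𝟙 (es (C i) (g c) u)) ⟩
    ∑[ i < m ] ∑[ c < n ] 𝟙 (es (C i) (g c) u)  ≡⟨ sum-cong-≗ (λ i → sum-cong-≗ λ c → 𝟙-es-sym (C i) (g c) u) ⟩
    ∑[ i < m ] ∑[ c < n ] 𝟙 (es (C i) u (g c))  ≤⟨ sum-mono-≤ bound ⟩
    sum F                                        ∎
    where open ≤-Reasoning

  c≤multiplicity+tops : ∀ j {k} .(j+k<h : j + suc k ≤ h) (u : TV Δ (suc k)) →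
    c[ j ] ≤ multiplicity (vertex (depth≤h j j+k<h) u) (vertex (<⇒≤ (depth≤h j j+k<h)) (parent u))
             + d * subtreeSum tops j j+k<h u
  c≤multiplicity+tops zero j+k<h u =
    ≤-trans (multiplicity-positive {vertex (depth≤h 0 j+k<h) u} {vertex (<⇒≤ (depth≤h 0 j+k<h)) (parent u)}
                                   (up (child-parent u)))
            (m≤m+n _ _)
  c≤multiplicity+tops (suc j) {k} j+k<h u = ceilDiv-≤ (X * c[ j ]) e (A + d * S) (begin
    X * c[ j ]                                       ≡⟨ sum-const X c[ j ] ⟨
    ∑[ c < X ] c[ j ]                                ≤⟨ sum-mono-≤ (λ c → c≤multiplicity+tops j _ (ext c u)) ⟩
    ∑[ c < X ] (multiplicity (Ch c) U + d * Sᶜ c)    ≡⟨ sum-+-* d (λ c → multiplicity (Ch c) U) Sᶜ ⟩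
    ∑[ c < X ] multiplicity (Ch c) U + d * sum Sᶜ    ≤⟨ +-monoˡ-≤ _ (multiplicity-towards U Ch _ perPiece) ⟩
    ∑[ i < m ] (Y * 𝟙 (es (C i) U P) + d * 𝟙 (isTop (C i) U)) + d * sum Sᶜ
      ≡⟨ cong (_+ d * sum Sᶜ) (sum-linear Y d (λ i → 𝟙 (es (C i) U P)) (λ i → 𝟙 (isTop (C i) U))) ⟩
    Y * A + d * tops U + d * sum Sᶜ                  ≡⟨ +-assoc (Y * A) _ _ ⟩
    Y * A + (d * tops U + d * sum Sᶜ)                ≡⟨ cong (Y * A +_) (*-distribˡ-+ d (tops U) (sum Sᶜ)) ⟨
    Y * A + d * S                                    ≤⟨ +-monoʳ-≤ (Y * A) (m≤n*m (d * S) Y) ⟩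
    Y * A + Y * (d * S)                              ≡⟨ *-distribˡ-+ Y A (d * S) ⟨
    Y * (A + d * S)                                  ∎)
    where
    open ≤-Reasoning
    X Y : ℕ
    X = Δ ∸ 1
    Y = suc e
    U P : Vertex Δ h
    U = vertex (depth≤h (suc j) j+k<h) u
    P = vertex (<⇒≤ (depth≤h (suc j) j+k<h)) (parent u)
    Ch : Fin X → Vertex Δ h
    Ch c = vertex (depth≤h j (height-child j j+k<h)) (ext c u)
    A S : ℕ
    A = multiplicity U P
    S = subtreeSum tops (suc j) j+k<h u
    Sᶜ : Fin X → ℕ
    Sᶜ c = subtreeSum tops j (height-child j j+k<h) (ext c u)
    perPiece : ∀ i → ∑[ c < X ] 𝟙 (es (C i) U (Ch c)) ≤ Y * 𝟙 (es (C i) U P) + d * 𝟙 (isTop (C i) U)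
    perPiece i = childEdges≤ Y (es (C i) U P) (vs (C i) U) _
      (edges≤degree (C i) (maxDeg i) U (neighbours (depth≤h j (height-child j j+k<h)) u)
                                        (neighbours-injective (depth≤h j (height-child j j+k<h)) u))

  Δ*c≤d*m : ∀ j → .(suc j + 0 ≤ h) → Δ * c[ j ] ≤ d * m
  Δ*c≤d*m j 1+j≤h = begin
    Δ * c[ j ]                                       ≡⟨ sum-const Δ c[ j ] ⟨
    ∑[ w < Δ ] c[ j ]                                ≤⟨ sum-mono-≤ (λ w → c≤multiplicity+tops j _ (top w)) ⟩
    ∑[ w < Δ ] (multiplicity (Ch w) R + d * Sᶜ w)    ≡⟨ sum-+-* d (λ w → multiplicity (Ch w) R) Sᶜ ⟩
    ∑[ w < Δ ] multiplicity (Ch w) R + d * sum Sᶜ    ≤⟨ +-monoˡ-≤ _ (multiplicity-towards R Ch _ perPiece) ⟩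
    ∑[ i < m ] (d * 𝟙 (isTop (C i) R)) + d * sum Sᶜ
      ≡⟨ cong (_+ d * sum Sᶜ) (*-distribˡ-sum d (λ i → 𝟙 (isTop (C i) R))) ⟨
    d * tops R + d * sum Sᶜ                          ≡⟨ *-distribˡ-+ d (tops R) (sum Sᶜ) ⟨
    d * subtreeSum tops (suc j) 1+j≤h root           ≤⟨ *-monoʳ-≤ d (subtreeSum-tops≤m (suc j) 1+j≤h root) ⟩
    d * m                                            ∎
    where
    open ≤-Reasoning
    R : Vertex Δ h
    R = vertex z≤n root
    Ch : Fin Δ → Vertex Δ h
    Ch w = vertex (depth≤h j (height-child j 1+j≤h)) (top w)
    Sᶜ : Fin Δ → ℕ
    Sᶜ w = subtreeSum tops j (height-child j 1+j≤h) (top w)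
    perPiece : ∀ i → ∑[ w < Δ ] 𝟙 (es (C i) R (Ch w)) ≤ d * 𝟙 (isTop (C i) R)
    perPiece i = edges≤degree (C i) (maxDeg i) R Ch (children-injective (depth≤h j (height-child j 1+j≤h)) root)

  lowerBound : 1 ≤ h → formula Δ d h ≤ m
  lowerBound 1≤h =
    ceilDiv-≤ _ (suc e) m (Δ*c≤d*m (h ∸ 1) (≤-reflexive (trans (+-identityʳ _) (m+[n∸m]≡n 1≤h))))

-- Upper bound

module UpperBound (δ e h : ℕ) (d≤Δ : suc (suc e) ≤ suc (suc δ)) where

  private
    Δ d X Y : ℕ
    Δ = suc (suc δ)
    d = suc (suc e)
    X = suc δ
    Y = suc e

  c[_] : ℕ → ℕ
  c[ j ] = ceilIter X Y j

  M : ℕ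
  M = formula Δ d h

  slots : ℕ → ℕ
  slots k = c[ h ∸ suc k ]

  upSlot : Fin X → ℕ → ℕ
  upSlot i s = (s * X + toℕ i) / Y

  label : ∀ {k} → TV Δ (suc k) → ℕ → ℕ
  label (top i)   s = (s * Δ + toℕ i) / d
  label (ext i u) s = label u (upSlot i s)

  c-positive : ∀ j → 0 < c[ j ]
  c-positive zero    = s≤s z≤n
  c-positive (suc j) with c[ suc j ] | ≤-*-ceilDiv (X * c[ j ]) e
  ... | suc _ | _      = s≤s z≤n
  ... | zero  | X*c≤0 = ⊥-elim (n≮0 (≤-trans (*-monoʳ-≤ X (c-positive j))
                                     (≤-trans X*c≤0 (≤-reflexive (*-zeroʳ Y)))))

  upSlot< : ∀ {k} i {s} → suc (suc k) ≤ h → s < slots (suc k) → upSlot i s < slots k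
  upSlot< {k} i 2+k≤h s< = subst (_ <_) (cong c[_] (sym (∸-suc 2+k≤h))) (stride-/-< s< (Fin.toℕ<n i))

  label<M : ∀ {k} (w : TV Δ (suc k)) {s} → suc k ≤ h → s < slots k → label w s < M
  label<M (top i)   _       s< = stride-/-< s< (Fin.toℕ<n i)
  label<M (ext i u) 2+k≤h s< = label<M u (<⇒≤ 2+k≤h) (upSlot< i 2+k≤h s<)

  label-injective : ∀ {k} (w : TV Δ (suc k)) {s s′} → label w s ≡ label w s′ → s ≡ s′
  label-injective (top i)   eq = stride-/-injective d≤Δ eq
  label-injective (ext i u) eq = stride-/-injective (≤-pred d≤Δ) (label-injective u eq)

  InPiece : ℕ → ∀ {k} → TV Δ (suc k) → Set
  InPiece p {k} w = ∃[ s ] label w (toℕ {slots k} s) ≡ p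

  inPiece? : ∀ p {k} (w : TV Δ (suc k)) → Dec (InPiece p w)
  inPiece? p w = Fin.any? λ s → label w (toℕ s) ≟ p

  InPiece-parent : ∀ {p k} (i : Fin X) (u : TV Δ (suc k)) → suc (suc k) ≤ h →
                   InPiece p (ext i u) → InPiece p u
  InPiece-parent i u 2+k≤h (s , eq) =
    fromℕ< (upSlot< i 2+k≤h (Fin.toℕ<n s)) , trans (cong (label u) (Fin.toℕ-fromℕ< _)) eq

  edgeUp : ℕ → Vertex Δ h → Bool
  edgeUp p (zero  , _ , root) = false
  edgeUp p (suc k , _ , w)    = ⌊ inPiece? p w ⌋

  isRoot : Vertex Δ h → Bool
  isRoot (zero  , _ , _) = true
  isRoot (suc _ , _ , _) = false

  data PieceEdge (p : ℕ) (x y : Vertex Δ h) : Set where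
    down : ParentOf x y → T (edgeUp p y) → PieceEdge p x y
    up   : ParentOf y x → T (edgeUp p x) → PieceEdge p x y

  pieceEdge? : ∀ p x y → Dec (PieceEdge p x y)
  pieceEdge? p x y = Dec.map′ [ uncurry down , uncurry up ] split
    ((parentOf? x y ×-dec T? (edgeUp p y)) ⊎-dec (parentOf? y x ×-dec T? (edgeUp p x)))
    where
    split : PieceEdge p x y → (ParentOf x y × T (edgeUp p y)) ⊎ (ParentOf y x × T (edgeUp p x))
    split (down par e) = inj₁ (par , e)
    split (up   par e) = inj₂ (par , e)

  edgeUp-parent : ∀ {p k q q′} {u : TV Δ k} {w} → Child u w →
                  T (edgeUp p (suc k , q′ , w)) → T (isRoot (k , q , u) ∨ edgeUp p (k , q , u))
  edgeUp-parent (child-top i) _ = _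
  edgeUp-parent {p} {q′ = q′} (child-ext i u) t =
    fromWitness (InPiece-parent i u q′ (toWitness {a? = inPiece? p (ext i u)} t))

  piece : ℕ → Subgraph (Adj {Δ} {h})
  piece p = record
    { vs     = λ x → isRoot x ∨ edgeUp p x
    ; es     = λ x y → ⌊ pieceEdge? p x y ⌋
    ; es⊆E   = λ x y t → edge⇒Adj (toWitness {a? = pieceEdge? p x y} t)
    ; es-sym = λ x y t → fromWitness (flip (toWitness {a? = pieceEdge? p x y} t))
    ; es-end = λ x y t → endpoint (toWitness {a? = pieceEdge? p x y} t)
    }
    where
    edge⇒Adj : ∀ {x y} → PieceEdge p x y → Adj x y
    edge⇒Adj (down par _) = proj₁ (ParentOf⇒Adj par)
    edge⇒Adj (up   par _) = proj₂ (ParentOf⇒Adj par)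
    flip : ∀ {x y} → PieceEdge p x y → PieceEdge p y x
    flip (down par e) = up par e
    flip (up   par e) = down par e
    endpoint : ∀ {x y} → PieceEdge p x y → T (isRoot x ∨ edgeUp p x)
    endpoint (down (parentOf {q′ = q′} ch) e) = edgeUp-parent {p} {q′ = q′} ch e
    endpoint (up (parentOf ch) e)             = e

  pieceEdge : ∀ {p} x y → PieceEdge p x y → T (es (piece p) x y)
  pieceEdge {p} x y = fromWitness {a? = pieceEdge? p x y}

  edgeOf : ∀ {p x y} → T (es (piece p) x y) → PieceEdge p x y
  edgeOf {p} {x} {y} = toWitness {a? = pieceEdge? p x y}

  climb : ∀ p {k} (q : k ≤ h) (w : TV Δ k) → T (isRoot (k , q , w) ∨ edgeUp p (k , q , w)) →
          Walk Adj (piece p) (k , q , w) (0 , z≤n , root)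
  climb p z≤n root      _ = here
  climb p q   (top i)   t =
    step (pieceEdge (_ , q , top i) (0 , z≤n , root) (up (parentOf (child-top i)) t)) here
  climb p q   (ext i u) t =
    step (pieceEdge (_ , q , ext i u) (_ , <⇒≤ q , u) (up (parentOf (child-ext i u)) t))
         (climb p (<⇒≤ q) u (edgeUp-parent {p} {q = <⇒≤ q} {q} (child-ext i u) t))

  piece-connected : ∀ p → Connected Adj (piece p)
  piece-connected p (_ , q , u) (_ , q′ , u′) u∈p u′∈p =
    climb p q u u∈p ++ʷ reverseʷ (climb p q′ u′ u′∈p)

  slot : ∀ {p k} (w : TV Δ (suc k)) → True (inPiece? p w) → ℕ
  slot {p} w t = toℕ (proj₁ (toWitness {a? = inPiece? p w} t))

  label-slot : ∀ {p k} (w : TV Δ (suc k)) (t : True (inPiece? p w)) → label w (slot w t) ≡ p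
  label-slot {p} w t = proj₂ (toWitness {a? = inPiece? p w} t)

  -- The Y child slots merged into one slot of a vertex are told apart by their residue mod Y; the parent gets code Y.
  code : ∀ {p x y} → PieceEdge p x y → ℕ
  code (down (parentOf (child-top i)) t)   = (slot (top i) t * Δ + toℕ i) % d
  code (down (parentOf (child-ext i u)) t) = (slot (ext i u) t * X + toℕ i) % Y
  code (up _ _)                            = Y

  code<d : ∀ {p x y} (t : PieceEdge p x y) → code t < d
  code<d (down (parentOf (child-top i)) t)   = m%n<n (slot (top i) t * Δ + toℕ i) d
  code<d (down (parentOf (child-ext i u)) t) = m<n⇒m<1+n (m%n<n (slot (ext i u) t * X + toℕ i) Y)
  code<d (up _ _)                            = n<1+n Y

  code-injective : ∀ {p x y y′} (t : PieceEdge p x y) (t′ : PieceEdge p x y′) → code t ≡ code t′ → y ≡ y′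
  code-injective (down (parentOf (child-top i)) t) (down (parentOf (child-top i′)) t′) same =
    vertex-cong (cong top (Fin.toℕ-injective
      (stride-digit-injective {s = slot (top i) t} {slot (top i′) t′} (Fin.toℕ<n i) (Fin.toℕ<n i′)
        (/-%-injective d (trans (label-slot (top i) t) (sym (label-slot (top i′) t′))) same))))
  code-injective (down (parentOf (child-ext i u)) t) (down (parentOf (child-ext i′ .u)) t′) same =
    vertex-cong (cong (λ i → ext i u) (Fin.toℕ-injective
      (stride-digit-injective {s = slot (ext i u) t} {slot (ext i′ u) t′} (Fin.toℕ<n i) (Fin.toℕ<n i′)
        (/-%-injective Y (label-injective u (trans (label-slot (ext i u) t) (sym (label-slot (ext i′ u) t′))))
                         same))))
  code-injective (down (parentOf (child-ext i u)) t) (up _ _) same =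
    ⊥-elim (<-irrefl same (m%n<n (slot (ext i u) t * X + toℕ i) Y))
  code-injective (up _ _) (down (parentOf (child-ext i u)) t) same =
    ⊥-elim (<-irrefl (sym same) (m%n<n (slot (ext i u) t * X + toℕ i) Y))
  code-injective (up (parentOf ch) _) (up (parentOf ch′) _) _ =
    vertex-cong (trans (sym (Child⇒parent ch)) (Child⇒parent ch′))

  piece-maxDeg : ∀ p → MaxDeg≤ Adj d (piece p)
  piece-maxDeg p = maxDeg≤-byCode (piece p)
    (code ∘ edgeOf) (code<d ∘ edgeOf) (λ t t′ → code-injective (edgeOf t) (edgeOf t′))

  pieceOf : ∀ {k} → suc k ≤ h → TV Δ (suc k) → Fin M
  pieceOf 1+k≤h w = fromℕ< (label<M w 1+k≤h (c-positive (h ∸ suc _)))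

  inPieceOf : ∀ {k} (1+k≤h : suc k ≤ h) (w : TV Δ (suc k)) →
              T (edgeUp (toℕ (pieceOf 1+k≤h w)) (suc k , 1+k≤h , w))
  inPieceOf 1+k≤h w = fromWitness (fromℕ< (c-positive (h ∸ suc _)) ,
    trans (cong (label w) (Fin.toℕ-fromℕ< _)) (sym (Fin.toℕ-fromℕ< _)))

  covers : ∀ x y → Adj x y → Σ[ i ∈ Fin M ] T (es (piece (toℕ i)) x y)
  covers x y (down {q = q} {w = w} ch) = pieceOf q w , pieceEdge x y (down (parentOf ch) (inPieceOf q w))
  covers x y (up   {q = q} {w = w} ch) = pieceOf q w , pieceEdge x y (up   (parentOf ch) (inPieceOf q w))

  covering : DegCovering Adj d M
  covering = piece ∘ toℕ , piece-connected ∘ toℕ , piece-maxDeg ∘ toℕ , covers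

mainTheorem14 : (Δ d h : ℕ) → 2 ≤ d → d ≤ Δ → 1 ≤ h →
    IsMinDegCoverNumber (Adj {Δ} {h}) d (formula Δ d h)
mainTheorem14 (suc (suc δ)) (suc (suc e)) h (s≤s (s≤s z≤n)) d≤Δ@(s≤s (s≤s _)) 1≤h =
  UpperBound.covering δ e h d≤Δ ,
  λ m (C , connected , maxDeg , covers) → LowerBound.lowerBound C connected maxDeg covers 1≤h
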